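{- For $n\ge 1$, the symmetric double star $D_n$ satisfies $\nu^*(D_n)=10n^2+10n+3$.
   Context: The symmetric double star $D_n$ is the graph formed by the disjoint union of two copies of the star $K_{1,n}$ together with one edge joining their two hubs. For a finite simple graph $G=(V,E)$ with $p=|V|$, $q=|E|$, $\ell=p+q$, a construction sequence (c-sequence) for $G$ is a bijection $x:\{1,\dots,\ell\}\to V\sqcup E$ such that for every edge $e=uw$, $x^{ -1}(e)>\max\{x^{ -1}(u),x^{ -1}(w)\}$. The cost of an edge $e=uw$ in $x$ is $\nu(e,x)=(x^{ -1}(e)-x^{ -1}(u))+(x^{ -1}(e)-x^{ -1}(w))$, and the cost of $x$ is $\nu(x)=\sum_{e\in E}\nu(e,x)$. The max cost of $G$ is $\nu^*(G)=\max\nu(x)$ over all c-sequences $x$ for $G$. -}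

module Defs where

open import Data.Nat using (ℕ; zero; suc; _+_; _*_; _∸_; _<_; _≤_)
open import Data.Fin using (Fin; zero; suc; toℕ; _↑ˡ_; _↑ʳ_; splitAt)
open import Data.Sum using (_⊎_; inj₁; inj₂)
open import Data.Product using (_×_; _,_; proj₁; proj₂; Σ; ∃)
open import Data.List using (List; map; allFin)
open import Data.Nat.ListAction using (sum)
open import Function.Bundles using (_↔_; Inverse)
open import Relation.Binary.PropositionalEquality using (_≡_)
open import Relation.Nullary using (¬_)

-- A finite simple graph with vertex set Fin p and edge set Fin q;
-- edge e joins the two vertices  ends e .
-- (Simplicity is not a field; the only graph used, D n, is simple by construction.)
record Graph : Set where
  field
    p : ℕ
    q : ℕ
    ends : Fin q → Fin p × Fin p

open Graph public

Elem : Graph → Set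
Elem G = Fin (p G) ⊎ Fin (q G)

len : Graph → ℕ
len G = p G + q G

-- position x⁻¹(a) of an element in the sequence x : Fin ℓ ↔ V ⊔ E
-- (0-based; cost only involves differences of positions)
pos : (G : Graph) → (Fin (len G) ↔ Elem G) → Elem G → ℕ
pos G x a = toℕ (Inverse.from x a)

IsCSeq : (G : Graph) → (Fin (len G) ↔ Elem G) → Set
IsCSeq G x = ∀ e → (pos G x (inj₁ (proj₁ (ends G e))) < pos G x (inj₂ e))
                 × (pos G x (inj₁ (proj₂ (ends G e))) < pos G x (inj₂ e))

CSeq : Graph → Set
CSeq G = Σ (Fin (len G) ↔ Elem G) (IsCSeq G)

edgeCost : (G : Graph) → (Fin (len G) ↔ Elem G) → Fin (q G) → ℕ
edgeCost G x e = (pos G x (inj₂ e) ∸ pos G x (inj₁ (proj₁ (ends G e))))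
               + (pos G x (inj₂ e) ∸ pos G x (inj₁ (proj₂ (ends G e))))

cost : (G : Graph) → CSeq G → ℕ
cost G (x , _) = sum (map (edgeCost G x) (allFin (q G)))

-- ν*(G) = m : m is the maximum of cost over all c-sequences
MaxCost : Graph → ℕ → Set
MaxCost G m = (∃ λ (x : CSeq G) → cost G x ≡ m) × (∀ (x : CSeq G) → cost G x ≤ m)

-- Vertices Fin (2 + (n + n)): 0 = hub a, 1 = hub b,
--   2 + j (j < n) = leaf j of a,  2 + n + j = leaf j of b.
-- Edges Fin (1 + (n + n)): 0 = ab, 1 + j = a–leaf_a j, 1 + n + j = b–leaf_b j.

DEnds : (n : ℕ) → Fin (suc (n + n)) → Fin (suc (suc (n + n))) × Fin (suc (suc (n + n)))
DEnds n zero = zero , suc zero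
DEnds n (suc i) with splitAt n i
... | inj₁ j = zero , suc (suc (j ↑ˡ n))
... | inj₂ j = suc zero , suc (suc (n ↑ʳ j))

D : ℕ → Graph
D n = record { p = suc (suc (n + n)) ; q = suc (n + n) ; ends = DEnds n }

-- Every edge e = uw of a c-sequence costs 2·pos e − pos u − pos w, so summing over the edges,
-- cost = 2·Σ_e pos e − Σ_v deg v · pos v.  The positions of all elements are 0, …, ℓ − 1, so
-- Σ_e pos e = T ℓ − Σ_v pos v with T m = 0 + 1 + ⋯ + (m − 1).  In D n the two hubs have degree
-- n + 1 and the leaves degree 1, whence cost = 2·T ℓ − 3·Σ_v pos v − n·(pos a + pos b).  The
-- vertices occupy distinct positions, so Σ_v pos v ≥ T p and pos a + pos b ≥ 1, and listing the
-- vertices first, hubs in front, attains both bounds; 2·T(4n+3) − 3·T(2n+2) − n = 10n² + 10n + 3.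
module Submission where

open import Defs
open import Data.Nat using (ℕ; zero; suc; pred; _+_; _*_; _∸_; _≤_; _<_; _≟_; z≤n; s≤s; s<s⁻¹; ≢-nonZero)
open import Data.Nat.Properties
open import Data.Nat.Tactic.RingSolver using (solve; solve-∀)
open import Data.Fin as Fin using (Fin; toℕ; _↑ˡ_; _↑ʳ_; splitAt; join; punchIn)
open import Data.Fin.Properties
  using (toℕ-injective; toℕ-↑ˡ; toℕ-↑ʳ; toℕ<n; join-splitAt; punchIn-injective; punchInᵢ≢i; any?; +↔⊎)
open import Data.Sum using (_⊎_; inj₁; inj₂; [_,_]′; map₁)
open import Data.Product using (_,_; proj₁; proj₂)
open import Data.List.Base using ([]; _∷_; map; allFin; tabulate)
import Data.Nat.ListAction as List
open import Data.List.Properties using (map-tabulate)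
open import Function.Base using (_∘_; id; const; case_of_)
open import Function.Bundles using (_↔_; Inverse)
open import Function.Definitions using (Injective)
open import Function.Construct.Composition using (_↔-∘_)
open import Function.Construct.Symmetry using (↔-sym)
open import Relation.Binary.PropositionalEquality
open import Relation.Nullary using (yes; no; contradiction)
open import Algebra.Properties.CommutativeSemigroup +-commutativeSemigroup using (interchange)
open import Algebra.Properties.CommutativeMonoid.Sum +-0-commutativeMonoid
  using (sum; sum-cong-≗; ∑-distrib-+; sum-remove; sum-permute)

sum-tabulate : ∀ {m} (f : Fin m → ℕ) → List.sum (tabulate f) ≡ sum f
sum-tabulate {zero}  f = refl
sum-tabulate {suc m} f = cong (f Fin.zero +_) (sum-tabulate (f ∘ Fin.suc))

sum-map-allFin : ∀ {m} (f : Fin m → ℕ) → List.sum (map f (allFin m)) ≡ sum f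
sum-map-allFin f = trans (cong List.sum (map-tabulate id f)) (sum-tabulate f)

sum-const : ∀ m c → sum {m} (const c) ≡ m * c
sum-const zero    c = refl
sum-const (suc m) c = cong (c +_) (sum-const m c)

sum-suc : ∀ {m} (f : Fin m → ℕ) → sum (suc ∘ f) ≡ m + sum f
sum-suc {m} f = begin
  sum (λ i → 1 + f i)       ≡⟨ ∑-distrib-+ (const 1) f ⟩
  sum {m} (const 1) + sum f ≡⟨ cong (_+ sum f) (trans (sum-const m 1) (*-identityʳ m)) ⟩
  m + sum f                 ∎
  where open ≡-Reasoning

sum-splitAt : ∀ m {k} (f : Fin m ⊎ Fin k → ℕ) →
              sum (f ∘ splitAt m) ≡ sum (f ∘ inj₁) + sum (f ∘ inj₂)
sum-splitAt zero    f = refl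
sum-splitAt (suc m) f = trans (cong (f (inj₁ Fin.zero) +_) (sum-splitAt m (f ∘ map₁ Fin.suc)))
                              (sym (+-assoc (f (inj₁ Fin.zero)) _ _))

sum-↔⊎ : ∀ {m k} (x : Fin (m + k) ↔ (Fin m ⊎ Fin k)) (f : Fin (m + k) → ℕ) →
         sum f ≡ sum (f ∘ Inverse.from x ∘ inj₁) + sum (f ∘ Inverse.from x ∘ inj₂)
sum-↔⊎ {m} x f = trans (sum-permute f (↔-sym x ↔-∘ +↔⊎)) (sum-splitAt m (f ∘ Inverse.from x))

m≢n⇒0<m+n : ∀ {m n} → m ≢ n → 0 < m + n
m≢n⇒0<m+n {zero}  {zero}  0≢0 = contradiction refl 0≢0
m≢n⇒0<m+n {zero}  {suc n} _   = s≤s z≤n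
m≢n⇒0<m+n {suc m} {n}     _   = s≤s z≤n

triangle : ℕ → ℕ
triangle m = sum {m} toℕ

triangle-suc : ∀ m → triangle (suc m) ≡ m + triangle m
triangle-suc m = sum-suc {m} toℕ

triangle-double : ∀ m → 2 * triangle (suc m) ≡ suc m * m
triangle-double zero    = refl
triangle-double (suc m) = begin
  2 * triangle (suc (suc m))       ≡⟨ cong (2 *_) (triangle-suc (suc m)) ⟩
  2 * (suc m + triangle (suc m))   ≡⟨ *-distribˡ-+ 2 (suc m) _ ⟩
  2 * suc m + 2 * triangle (suc m) ≡⟨ cong (2 * suc m +_) (triangle-double m) ⟩
  2 * suc m + suc m * m            ≡⟨ solve (m ∷ []) ⟩
  suc (suc m) * suc m              ∎
  where open ≡-Reasoning

-- m distinct naturals below B sum to at least triangle m.  Induction on B: if 0 is not a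
-- value, lower every value by one; otherwise remove the zero and lower the others.
mutual
  triangle≤sum-distinct : ∀ B {m} (g : Fin m → ℕ) → Injective _≡_ _≡_ g → (∀ i → g i < B) →
                          triangle m ≤ sum g
  triangle≤sum-distinct zero    {zero}  g _ _   = z≤n
  triangle≤sum-distinct zero    {suc m} g _ g<0 = contradiction (g<0 Fin.zero) λ ()
  triangle≤sum-distinct (suc B) {m}     g inj g<B with any? (λ i → g i ≟ 0)
  ... | yes (i , gᵢ≡0) = triangle≤sum-withZero B g inj g<B i gᵢ≡0
  ... | no  0∉g        = ≤-trans (m≤n+m (triangle m) m)
                                 (suc-triangle≤sum-positive B g inj (λ i gᵢ≡0 → 0∉g (i , gᵢ≡0)) g<B)

  triangle≤sum-withZero : ∀ B {m} (g : Fin m → ℕ) → Injective _≡_ _≡_ g → (∀ i → g i < suc B) →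
                          (i : Fin m) → g i ≡ 0 → triangle m ≤ sum g
  triangle≤sum-withZero B {suc m} g inj g<B i gᵢ≡0 = begin
    triangle (suc m)          ≡⟨ triangle-suc m ⟩
    m + triangle m            ≤⟨ suc-triangle≤sum-positive B (g ∘ punchIn i)
                                   (punchIn-injective i _ _ ∘ inj) positive (g<B ∘ punchIn i) ⟩
    sum (g ∘ punchIn i)       ≤⟨ m≤n+m _ (g i) ⟩
    g i + sum (g ∘ punchIn i) ≡⟨ sum-remove g ⟨
    sum g                     ∎
    where
    open ≤-Reasoning
    positive : ∀ j → g (punchIn i j) ≢ 0
    positive j gⱼ≡0 = punchInᵢ≢i i j (inj (trans gⱼ≡0 (sym gᵢ≡0)))

  suc-triangle≤sum-positive : ∀ B {m} (g : Fin m → ℕ) → Injective _≡_ _≡_ g → (∀ i → g i ≢ 0) →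
                              (∀ i → g i < suc B) → m + triangle m ≤ sum g
  suc-triangle≤sum-positive B {m} g inj g≢0 g<B = begin
    m + triangle m       ≤⟨ +-monoʳ-≤ m (triangle≤sum-distinct B (pred ∘ g) pred-inj pred<B) ⟩
    m + sum (pred ∘ g)   ≡⟨ sum-suc (pred ∘ g) ⟨
    sum (suc ∘ pred ∘ g) ≡⟨ sum-cong-≗ (sym ∘ g≡suc-pred) ⟩
    sum g                ∎
    where
    open ≤-Reasoning
    g≡suc-pred : ∀ i → g i ≡ suc (pred (g i))
    g≡suc-pred i = sym (suc-pred (g i) {{≢-nonZero (g≢0 i)}})
    pred-inj : Injective _≡_ _≡_ (pred ∘ g)
    pred-inj {i} {j} eq = inj (trans (g≡suc-pred i) (trans (cong suc eq) (sym (g≡suc-pred j))))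
    pred<B : ∀ i → pred (g i) < B
    pred<B i = s<s⁻¹ (subst (_< suc B) (g≡suc-pred i) (g<B i))

module _ (G : Graph) (x : Fin (len G) ↔ Elem G) where

  vertexPos : Fin (p G) → ℕ
  vertexPos v = pos G x (inj₁ v)

  edgePos : Fin (q G) → ℕ
  edgePos e = pos G x (inj₂ e)

  endsPos : Fin (q G) → ℕ
  endsPos e = vertexPos (proj₁ (ends G e)) + vertexPos (proj₂ (ends G e))

  sum-vertexPos+sum-edgePos : sum vertexPos + sum edgePos ≡ triangle (len G)
  sum-vertexPos+sum-edgePos = sym (sum-↔⊎ x toℕ)

  vertexPos-injective : Injective _≡_ _≡_ vertexPos
  vertexPos-injective {u} {v} eq = inj₁-injective (begin
    inj₁ u                                 ≡⟨ Inverse.strictlyInverseˡ x (inj₁ u) ⟨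
    Inverse.to x (Inverse.from x (inj₁ u)) ≡⟨ cong (Inverse.to x) (toℕ-injective eq) ⟩
    Inverse.to x (Inverse.from x (inj₁ v)) ≡⟨ Inverse.strictlyInverseˡ x (inj₁ v) ⟩
    inj₁ v                                 ∎)
    where
    open ≡-Reasoning
    inj₁-injective : ∀ {a b : Fin (p G)} → _≡_ {A = Elem G} (inj₁ a) (inj₁ b) → a ≡ b
    inj₁-injective refl = refl

  triangle≤sum-vertexPos : triangle (p G) ≤ sum vertexPos
  triangle≤sum-vertexPos =
    triangle≤sum-distinct (len G) vertexPos vertexPos-injective (λ v → toℕ<n (Inverse.from x (inj₁ v)))

  -- The c-sequence condition is what keeps the truncated subtractions in edgeCost exact.
  edgeCost+endsPos : IsCSeq G x → ∀ e → edgeCost G x e + endsPos e ≡ edgePos e + edgePos e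
  edgeCost+endsPos isCSeq e = begin
    (E ∸ U + (E ∸ W)) + (U + W) ≡⟨ interchange (E ∸ U) (E ∸ W) U W ⟩
    (E ∸ U + U) + (E ∸ W + W)   ≡⟨ cong₂ _+_ (m∸n+n≡m (<⇒≤ (proj₁ (isCSeq e)))) (m∸n+n≡m (<⇒≤ (proj₂ (isCSeq e)))) ⟩
    E + E                       ∎
    where
    open ≡-Reasoning
    E = edgePos e
    U = vertexPos (proj₁ (ends G e))
    W = vertexPos (proj₂ (ends G e))

  cost+sum-endsPos : (isCSeq : IsCSeq G x) → cost G (x , isCSeq) + sum endsPos ≡ sum edgePos + sum edgePos
  cost+sum-endsPos isCSeq = begin
    cost G (x , isCSeq) + sum endsPos      ≡⟨ cong (_+ sum endsPos) (sum-map-allFin (edgeCost G x)) ⟩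
    sum (edgeCost G x) + sum endsPos       ≡⟨ ∑-distrib-+ (edgeCost G x) endsPos ⟨
    sum (λ e → edgeCost G x e + endsPos e) ≡⟨ sum-cong-≗ (edgeCost+endsPos isCSeq) ⟩
    sum (λ e → edgePos e + edgePos e)      ≡⟨ ∑-distrib-+ edgePos edgePos ⟩
    sum edgePos + sum edgePos              ∎
    where open ≡-Reasoning

verticesFirst : (G : Graph) → CSeq G
verticesFirst G = +↔⊎ , λ e → vertex<edge _ e , vertex<edge _ e
  where
  vertex<edge : ∀ v e → toℕ (v ↑ˡ q G) < toℕ (p G ↑ʳ e)
  vertex<edge v e rewrite toℕ-↑ˡ v (q G) | toℕ-↑ʳ (p G) e = ≤-trans (toℕ<n v) (m≤m+n (p G) (toℕ e))

sum-vertexPos-verticesFirst : (G : Graph) → sum (vertexPos G +↔⊎) ≡ triangle (p G)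
sum-vertexPos-verticesFirst G = sum-cong-≗ {p G} (λ v → toℕ-↑ˡ v (q G))

module DoubleStar (n : ℕ) (x : Fin (len (D n)) ↔ Elem (D n)) where

  hubPos : Fin n ⊎ Fin n → ℕ
  hubPos = [ const (vertexPos (D n) x Fin.zero) , const (vertexPos (D n) x (Fin.suc Fin.zero)) ]′

  leafPos : Fin (n + n) → ℕ
  leafPos i = vertexPos (D n) x (Fin.suc (Fin.suc i))

  hubSum : ℕ
  hubSum = vertexPos (D n) x Fin.zero + vertexPos (D n) x (Fin.suc Fin.zero)

  weight : ℕ
  weight = 3 * sum (vertexPos (D n) x) + n * hubSum

  endsPos-leafEdge : ∀ i → endsPos (D n) x (Fin.suc i) ≡ hubPos (splitAt n i) + leafPos i
  endsPos-leafEdge i = trans (viaSplitAt i) (cong (λ k → hubPos (splitAt n i) + leafPos k) (join-splitAt n n i))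
    where
    viaSplitAt : ∀ i → endsPos (D n) x (Fin.suc i) ≡ hubPos (splitAt n i) + leafPos (join n n (splitAt n i))
    viaSplitAt i with splitAt n i
    ... | inj₁ _ = refl
    ... | inj₂ _ = refl

  sum-endsPos : sum (endsPos (D n) x) ≡ sum (vertexPos (D n) x) + n * hubSum
  sum-endsPos = begin
    hubSum + sum (endsPos (D n) x ∘ Fin.suc)
      ≡⟨ cong (hubSum +_) (sum-cong-≗ endsPos-leafEdge) ⟩
    hubSum + sum (λ i → hubPos (splitAt n i) + leafPos i)
      ≡⟨ cong (hubSum +_) (∑-distrib-+ (hubPos ∘ splitAt n) leafPos) ⟩
    hubSum + (sum (hubPos ∘ splitAt n) + sum leafPos)
      ≡⟨ cong (λ s → hubSum + (s + sum leafPos)) (sum-splitAt n hubPos) ⟩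
    hubSum + (sum {n} (const α) + sum {n} (const β) + sum leafPos)
      ≡⟨ cong₂ (λ s t → hubSum + (s + t + sum leafPos)) (sum-const n α) (sum-const n β) ⟩
    hubSum + (n * α + n * β + sum leafPos)
      ≡⟨ regroup n α β (sum leafPos) ⟩
    (α + (β + sum leafPos)) + n * hubSum
      ∎
    where
    open ≡-Reasoning
    α = vertexPos (D n) x Fin.zero
    β = vertexPos (D n) x (Fin.suc Fin.zero)
    regroup : ∀ n a b l → (a + b) + (n * a + n * b + l) ≡ (a + (b + l)) + n * (a + b)
    regroup = solve-∀

  cost+weight : (isCSeq : IsCSeq (D n) x) → cost (D n) (x , isCSeq) + weight ≡ 2 * triangle (len (D n))
  cost+weight isCSeq = begin
    c + (3 * V + n * hubSum)            ≡⟨ split-weight c V n hubSum ⟩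
    (c + (V + n * hubSum)) + 2 * V      ≡⟨ cong (λ s → (c + s) + 2 * V) sum-endsPos ⟨
    (c + sum (endsPos (D n) x)) + 2 * V ≡⟨ cong (_+ 2 * V) (cost+sum-endsPos (D n) x isCSeq) ⟩
    (Eₛ + Eₛ) + 2 * V                   ≡⟨ regroup Eₛ V ⟩
    2 * (V + Eₛ)                        ≡⟨ cong (2 *_) (sum-vertexPos+sum-edgePos (D n) x) ⟩
    2 * triangle (len (D n))            ∎
    where
    open ≡-Reasoning
    c = cost (D n) (x , isCSeq)
    V = sum (vertexPos (D n) x)
    Eₛ = sum (edgePos (D n) x)
    split-weight : ∀ c v n h → c + (3 * v + n * h) ≡ (c + (v + n * h)) + 2 * v
    split-weight = solve-∀
    regroup : ∀ e v → (e + e) + 2 * v ≡ 2 * (v + e)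
    regroup = solve-∀

  0<hubSum : 0 < hubSum
  0<hubSum = m≢n⇒0<m+n (λ eq → case vertexPos-injective (D n) x eq of λ ())

  weight-lowerBound : 3 * triangle (p (D n)) + n * 1 ≤ weight
  weight-lowerBound = +-mono-≤ (*-monoʳ-≤ 3 (triangle≤sum-vertexPos (D n) x)) (*-monoʳ-≤ n 0<hubSum)

weight-verticesFirst : ∀ n → DoubleStar.weight n +↔⊎ ≡ 3 * triangle (p (D n)) + n * 1
weight-verticesFirst n = cong (λ t → 3 * t + n * 1) (sum-vertexPos-verticesFirst (D n))

maxCost+minWeight : ∀ n → (10 * n * n + 10 * n + 3) + (3 * triangle (p (D n)) + n * 1) ≡ 2 * triangle (len (D n))
maxCost+minWeight n = *-cancelˡ-≡ _ _ 2 (begin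
  2 * ((10 * n * n + 10 * n + 3) + (3 * Tₚ + n * 1))
    ≡⟨ expand n Tₚ ⟩
  2 * (10 * n * n + 11 * n + 3) + 3 * (2 * Tₚ)
    ≡⟨ cong (λ t → 2 * (10 * n * n + 11 * n + 3) + 3 * t) (triangle-double (suc (n + n))) ⟩
  2 * (10 * n * n + 11 * n + 3) + 3 * (suc (suc (n + n)) * suc (n + n))
    ≡⟨ closedForm n ⟩
  2 * (suc (suc (n + n) + suc (n + n)) * (suc (n + n) + suc (n + n)))
    ≡⟨ cong (2 *_) (triangle-double (suc (n + n) + suc (n + n))) ⟨
  2 * (2 * triangle (len (D n)))
    ∎)
  where
  open ≡-Reasoning
  Tₚ = triangle (p (D n))
  expand : ∀ n t → 2 * ((10 * n * n + 10 * n + 3) + (3 * t + n * 1)) ≡ 2 * (10 * n * n + 11 * n + 3) + 3 * (2 * t)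
  expand = solve-∀
  closedForm : ∀ n → 2 * (10 * n * n + 11 * n + 3) + 3 * (suc (suc (n + n)) * suc (n + n))
                     ≡ 2 * (suc (suc (n + n) + suc (n + n)) * (suc (n + n) + suc (n + n)))
  closedForm = solve-∀

theorem6 : ∀ (n : ℕ) → 1 ≤ n → MaxCost (D n) (10 * n * n + 10 * n + 3)
theorem6 n _ = (verticesFirst (D n) , attained) , bounded
  where
  open DoubleStar n
  K = 10 * n * n + 10 * n + 3
  minWeight = 3 * triangle (p (D n)) + n * 1
  attained : cost (D n) (verticesFirst (D n)) ≡ K
  attained = +-cancelʳ-≡ _ _ _ (begin
    cost (D n) (verticesFirst (D n)) + minWeight ≡⟨ cong (cost (D n) (verticesFirst (D n)) +_) (weight-verticesFirst n) ⟨
    cost (D n) (verticesFirst (D n)) + weight +↔⊎ ≡⟨ cost+weight +↔⊎ (proj₂ (verticesFirst (D n))) ⟩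
    2 * triangle (len (D n))                     ≡⟨ maxCost+minWeight n ⟨
    K + minWeight                                ∎)
    where open ≡-Reasoning
  bounded : ∀ y → cost (D n) y ≤ K
  bounded (y , isCSeq) = +-cancelʳ-≤ (weight y) _ _ (begin
    cost (D n) (y , isCSeq) + weight y ≡⟨ cost+weight y isCSeq ⟩
    2 * triangle (len (D n))           ≡⟨ maxCost+minWeight n ⟨
    K + minWeight                      ≤⟨ +-monoʳ-≤ K (weight-lowerBound y) ⟩
    K + weight y                       ∎)
    where open ≤-Reasoning
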